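{- Let $t\ge 1$ and $s\ge 2$ be integers. Then $\chi_p(P_{2t}\Diamond_2 C_{4s+1})\le 4$ if $1\le t\le 3$, and $\chi_p(P_{2t}\Diamond_2 C_{4s+1})\le 5$ if $t\ge 4$. Moreover, equality holds for $t\in\{1,2,3\}$.
   Context: A packing $k$-coloring of a graph $H$ is a map $c:V(H)\to\{1,\ldots,k\}$ such that any two distinct vertices $u,v$ with $c(u)=c(v)=i$ satisfy $d_H(u,v)\ge i+1$. The packing chromatic number $\chi_p(H)$ is the least such $k$. $P_m$ denotes the path $v_1\cdots v_m$ and $C_n$ the cycle on $n$ vertices. Path-aligned product: for positive integers $\ell\mid m$ and a connected vertex-transitive graph $G$ containing $P_\ell$ as a subgraph, $P_m\Diamond_\ell G$ is formed from the path $P_m=v_1\cdots v_m$ and $m/\ell$ pairwise disjoint copies of $G$, where for each $1\le i\le m/\ell$ the consecutive path vertices $v_{(i-1)\ell+1},\ldots,v_{i\ell}$ are identified, in order, with the vertices of a path $P_\ell$ (i.e. $\ell$ consecutive cycle vertices when $G$ is a cycle) in the $i$-th copy of $G$. -}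

module Defs where

open import Data.Nat using (ℕ; zero; suc; _+_; _*_; _∸_; _<_; _≤_)
open import Data.Fin using (Fin; toℕ)
open import Data.Product using (Σ; _×_; _,_)
open import Data.Sum using (_⊎_)
open import Relation.Nullary using (¬_)
open import Relation.Binary.PropositionalEquality using (_≡_; _≢_)

record Graph : Set₁ where
  field
    V   : Set
    Adj : V → V → Set
open Graph public

data Walk (H : Graph) : ℕ → V H → V H → Set where
  here : ∀ {u} → Walk H 0 u u
  step : ∀ {k u w v} → Adj H u w → Walk H k w v → Walk H (suc k) u v

DistGE : (H : Graph) → V H → V H → ℕ → Set
DistGE H u v d = ∀ k → k < d → ¬ Walk H k u v

-- Packing k-coloring: colour c ∈ Fin k stands for the colour toℕ c + 1 ∈ {1..k}.
IsPackingColoring : (H : Graph) (k : ℕ) → (V H → Fin k) → Set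
IsPackingColoring H k c =
  ∀ u v → u ≢ v → c u ≡ c v → DistGE H u v (suc (suc (toℕ (c u))))

PackingColorable : Graph → ℕ → Set
PackingColorable H k = Σ (V H → Fin k) (IsPackingColoring H k)

χp≤ : Graph → ℕ → Set
χp≤ H k = PackingColorable H k

χp≡ : Graph → ℕ → Set
χp≡ H k = PackingColorable H k × (∀ j → j < k → ¬ PackingColorable H j)

CycleStep : (n : ℕ) → Fin n → Fin n → Set
CycleStep n j j' = (toℕ j' ≡ suc (toℕ j)) ⊎ ((suc (toℕ j) ≡ n) × (toℕ j' ≡ 0))

-- One direction of the path edges joining copy i to copy i+1:
-- the last path vertex v_{iℓ} (cycle vertex ℓ-1 of copy i) is adjacent to
-- the first path vertex v_{iℓ+1} (cycle vertex 0 of copy i+1).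
ProdStep : (ℓ q n : ℕ) → Fin q × Fin n → Fin q × Fin n → Set
ProdStep ℓ q n (i , j) (i' , j') =
  ((i ≡ i') × CycleStep n j j')
  ⊎ ((toℕ i' ≡ suc (toℕ i)) × (toℕ j ≡ ℓ ∸ 1) × (toℕ j' ≡ 0))

-- P_{qℓ} ◇_ℓ C_n : q copies of C_n (vertices (i , j), copy i, cycle position j);
-- path vertex v_{iℓ+r+1} (0 ≤ r < ℓ) is identified with vertex r of copy i.
-- Path edges inside a copy are cycle edges; the remaining path edges are ProdStep's
-- second disjunct.
PathCycleProduct : (ℓ q n : ℕ) → Graph
PathCycleProduct ℓ q n = record
  { V   = Fin q × Fin n
  ; Adj = λ x y → ProdStep ℓ q n x y ⊎ ProdStep ℓ q n y x
  }

{-# OPTIONS --safe #-}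
module Submission where

-- Lower bound: along a copy of C_{4s+1} a packing 3-coloring cannot leave four consecutive vertices
-- without color 3 (colors 1 and 2 would have to alternate), and two vertices of color 3 are at
-- distance at least 4; so color 3 recurs with period exactly 4, which is impossible on a cycle of
-- length 1 mod 4.
--
-- Upper bound: vertex j of copy i gets a color depending only on the type of copy i (the types
-- run 0, 1, 2, 3, 4, 3, 4, …) and on a label of j, the labelling being a homomorphism from the
-- directed cycle onto a 13-vertex digraph. Collapsing all other copies onto the two bridge ends of
-- a copy is non-expansive, so distances inside a copy are cycle distances, and a walk between
-- copies pays for every bridge it crosses. Every packing constraint thereby becomes a statement
-- about paths in the finite label digraph, which is decided by computation. Only copies of type at
-- least 3 use color 5, which gives the 4-coloring for t ≤ 3.

open import Defs
open import Data.Nat using (ℕ; zero; suc; _+_; _*_; _∸_; _≤_; _<_; z≤n; s≤s; z<s; _≤?_; _<?_; NonZero)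
open import Data.Nat.Properties
open import Data.Nat.DivMod
  using (_%_; _/_; _mod_; m%n<n; [m+n]%n≡m%n; %-distribˡ-+; m<n⇒m%n≡m; n%n≡0; m≡m%n+[m/n]*n)
open import Data.Nat.Divisibility using (_∣_; ∣m+n∣m⇒∣n; ∣⇒≤; n∣m*n)
open import Data.Nat.GeneralisedArithmetic using (iterate)
open import Data.Nat.Tactic.RingSolver using (solve-∀)
open import Data.Fin using (Fin; toℕ; fromℕ<; inject≤; #_) renaming (zero to fzero; suc to fsuc)
open import Data.Fin.Properties
  using (all?; toℕ<n; toℕ-injective; toℕ-fromℕ<; toℕ-inject≤) renaming (_≟_ to _≟ᶠ_)
open import Data.List using (List; []; _∷_)
open import Data.List.Membership.Propositional using (_∈_; find; lose)
open import Data.List.Relation.Unary.Any using (here; there; any?)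
open import Data.Vec using (Vec; lookup) renaming (_∷_ to _∷ᵥ_; [] to []ᵥ)
open import Data.Product using (∃; ∃₂; _×_; _,_; proj₁; proj₂)
open import Data.Product.Properties using (,-injectiveʳ)
open import Data.Sum using (_⊎_; inj₁; inj₂; swap)
open import Data.Empty using (⊥)
open import Function using (_∘_; flip)
open import Relation.Binary using (tri<; tri≈; tri>)
open import Relation.Binary.Construct.Closure.Reflexive using (ReflClosure; [_]; reflexive)
open import Relation.Binary.Construct.Closure.Symmetric using (SymClosure; fwd; bwd)
open import Relation.Nullary using (¬_; Dec; yes; no; contradiction)
open import Relation.Nullary.Decidable using (map′; from-yes; decidable-stable; _→-dec_; _⊎-dec_; ¬?)
open import Relation.Binary.PropositionalEquality

data Path {A : Set} (R : A → A → Set) : ℕ → A → A → Set where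
  [] : ∀ {a} → Path R 0 a a
  _∷_ : ∀ {k a b c} → R a b → Path R k b c → Path R (suc k) a c

module _ {A : Set} {R : A → A → Set} where

  _∷ʳ_ : ∀ {k a b c} → Path R k a b → R b c → Path R (suc k) a c
  [] ∷ʳ r = r ∷ []
  (r′ ∷ p) ∷ʳ r = r′ ∷ (p ∷ʳ r)

  reverse : ∀ {k a b} → Path (flip R) k a b → Path R k b a
  reverse [] = []
  reverse (r ∷ p) = reverse p ∷ʳ r

  Path-length0 : ∀ {a b} → Path R 0 a b → a ≡ b
  Path-length0 [] = refl

  Path-nonempty : ∀ {k a b} → a ≢ b → Path R k a b → 0 < k
  Path-nonempty a≢b [] = contradiction refl a≢b
  Path-nonempty a≢b (_ ∷ _) = z<s

OneWay : {A : Set} → (A → A → Set) → ℕ → A → A → Set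
OneWay R d a b = Path R d a b ⊎ Path R d b a

OneWay-length0 : ∀ {A : Set} {R : A → A → Set} {a b} → OneWay R 0 a b → a ≡ b
OneWay-length0 (inj₁ p) = Path-length0 p
OneWay-length0 (inj₂ p) = sym (Path-length0 p)

Path-map : ∀ {A B : Set} {R : A → A → Set} {S : B → B → Set} (f : A → B) →
           (∀ {a b} → R a b → S (f a) (f b)) → ∀ {k a b} → Path R k a b → Path S k (f a) (f b)
Path-map f hom [] = []
Path-map f hom (r ∷ p) = hom r ∷ Path-map f hom p

OneWay-map : ∀ {A B : Set} {R : A → A → Set} {S : B → B → Set} (f : A → B) →
             (∀ {a b} → R a b → S (f a) (f b)) → ∀ {k a b} → OneWay R k a b → OneWay S k (f a) (f b)
OneWay-map f hom (inj₁ p) = inj₁ (Path-map f hom p)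
OneWay-map f hom (inj₂ p) = inj₂ (Path-map f hom p)

module _ {H : Graph} (symmetric : ∀ {u v} → Adj H u v → Adj H v u) where

  private
    _∷ʷ_ : ∀ {k u v w} → Walk H k u v → Adj H v w → Walk H (suc k) u w
    here ∷ʷ a = step a here
    step a′ w ∷ʷ a = step a′ (w ∷ʷ a)

  Walk-reverse : ∀ {k u v} → Walk H k u v → Walk H k v u
  Walk-reverse here = here
  Walk-reverse (step a w) = Walk-reverse w ∷ʷ symmetric a

Walk-map : ∀ {H : Graph} {B : Set} {S : B → B → Set} (f : V H → B) →
           (∀ {u v} → Adj H u v → S (f u) (f v)) → ∀ {k u v} → Walk H k u v → Path S k (f u) (f v)
Walk-map f hom here = []
Walk-map f hom (step a w) = hom a ∷ Walk-map f hom w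

Lazy : {A : Set} → (A → A → Set) → A → A → Set
Lazy R = ReflClosure (SymClosure R)

module _ {A : Set} {R : A → A → Set}
         (functional : ∀ {a b b′} → R a b → R a b′ → b ≡ b′)
         (injective : ∀ {a a′ b} → R a b → R a′ b → a ≡ a′) where

  -- Since R is functional and injective, a step against the direction of the rest of the path
  -- cancels against the first step of that rest.
  private
    straighten : ∀ {k a b} → Path (Lazy R) k a b →
                 ∃ λ d → d ≤ k × (Path R d a b ⊎ Path (flip R) d a b)
    straighten [] = 0 , z≤n , inj₁ []
    straighten (ReflClosure.refl ∷ p) with straighten p
    ... | d , d≤k , q = d , m≤n⇒m≤1+n d≤k , q
    straighten ([ fwd r ] ∷ p) with straighten p
    ... | d , d≤k , inj₁ q = suc d , s≤s d≤k , inj₁ (r ∷ q)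
    ... | zero , _ , inj₂ [] = 1 , s≤s z≤n , inj₁ (r ∷ [])
    ... | suc d , d≤k , inj₂ (r′ ∷ q) with injective r r′
    ...   | refl = d , ≤-trans (n≤1+n d) (m≤n⇒m≤1+n d≤k) , inj₂ q
    straighten ([ bwd r ] ∷ p) with straighten p
    ... | d , d≤k , inj₂ q = suc d , s≤s d≤k , inj₂ (r ∷ q)
    ... | zero , _ , inj₁ [] = 1 , s≤s z≤n , inj₂ (r ∷ [])
    ... | suc d , d≤k , inj₁ (r′ ∷ q) with functional r r′
    ...   | refl = d , ≤-trans (n≤1+n d) (m≤n⇒m≤1+n d≤k) , inj₁ q

  shortcut : ∀ {k a b} → Path (Lazy R) k a b → ∃ λ d → d ≤ k × OneWay R d a b
  shortcut p with straighten p
  ... | d , d≤k , inj₁ q = d , d≤k , inj₁ q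
  ... | d , d≤k , inj₂ q = d , d≤k , inj₂ (reverse q)

recolor : ∀ {H k k′} {c : V H → Fin k} → IsPackingColoring H k c →
           (c′ : V H → Fin k′) → (∀ v → toℕ (c′ v) ≡ toℕ (c v)) → IsPackingColoring H k′ c′
recolor {H} {c = c} packing c′ same u v u≢v c′u≡c′v =
  subst (λ x → DistGE H u v (suc (suc x))) (sym (same u)) (packing u v u≢v cu≡cv)
  where
  cu≡cv : c u ≡ c v
  cu≡cv = toℕ-injective (trans (sym (same u)) (trans (cong toℕ c′u≡c′v) (same v)))

restrict-colors : ∀ {H k k′} {c : V H → Fin k} → IsPackingColoring H k c →
                  (∀ v → toℕ (c v) < k′) → PackingColorable H k′
restrict-colors packing small = (λ v → fromℕ< (small v)) , recolor packing _ (λ v → toℕ-fromℕ< (small v))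

PackingColorable-mono : ∀ {H k k′} → k ≤ k′ → PackingColorable H k → PackingColorable H k′
PackingColorable-mono k≤k′ (c , packing) =
  (λ v → inject≤ (c v) k≤k′) , recolor packing _ (λ v → toℕ-inject≤ (c v) k≤k′)

two-colors-alternate : (x y z : Fin 3) → x ≢ # 2 → y ≢ # 2 → z ≢ # 2 → x ≢ y → y ≢ z → x ≡ z
two-colors-alternate fzero fzero _ _ _ _ x≢y _ = contradiction refl x≢y
two-colors-alternate fzero (fsuc fzero) fzero _ _ _ _ _ = refl
two-colors-alternate (fsuc fzero) fzero (fsuc fzero) _ _ _ _ _ = refl
two-colors-alternate (fsuc fzero) (fsuc fzero) _ _ _ _ x≢y _ = contradiction refl x≢y
two-colors-alternate _ fzero fzero _ _ _ _ y≢z = contradiction refl y≢z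
two-colors-alternate _ (fsuc fzero) (fsuc fzero) _ _ _ _ y≢z = contradiction refl y≢z
two-colors-alternate (fsuc (fsuc fzero)) _ _ x≢2 _ _ _ _ = contradiction refl x≢2
two-colors-alternate _ (fsuc (fsuc fzero)) _ _ y≢2 _ _ _ = contradiction refl y≢2
two-colors-alternate _ _ (fsuc (fsuc fzero)) _ _ z≢2 _ _ = contradiction refl z≢2

module ClosedWalk {H : Graph} (w : ℕ → V H)
    (adjacent : ∀ a → Adj H (w a) (w (suc a)))
    (distinct-nearby : ∀ a d → 0 < d → d ≤ 3 → w a ≢ w (d + a))
    {q r : ℕ} (0<r : 0 < r) (r≤3 : r ≤ 3)
    (closed : ∀ a → w (a + (4 * q + r)) ≡ w a) where

  walk-along : ∀ d a → Walk H d (w a) (w (d + a))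
  walk-along zero a = here
  walk-along (suc d) a =
    step (adjacent a) (subst (λ b → Walk H d (w (suc a)) (w b)) (+-suc d a) (walk-along d (suc a)))

  no-packing-3-coloring : ¬ PackingColorable H 3
  no-packing-3-coloring (c , packing) =
    no-three-free-window 0 (no-three 0) (no-three 1) (no-three 2) (no-three 3)
    where
    f : ℕ → Fin 3
    f a = c (w a)

    spread : ∀ a d → 0 < d → d ≤ 3 → f a ≡ f (d + a) → 2 + toℕ (f a) ≤ d
    spread a d 0<d d≤3 same = ≮⇒≥ λ d<2+fa →
      packing (w a) (w (d + a)) (distinct-nearby a d 0<d d≤3) same d d<2+fa (walk-along d a)

    neighbours-differ : ∀ a → f a ≢ f (1 + a)
    neighbours-differ a same with spread a 1 (s≤s z≤n) (s≤s z≤n) same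
    ... | s≤s ()

    at-distance-2 : ∀ a → f a ≡ f (2 + a) → toℕ (f a) ≡ 0
    at-distance-2 a same with spread a 2 (s≤s z≤n) (s≤s (s≤s z≤n)) same
    ... | s≤s (s≤s fa≤0) = n≤0⇒n≡0 fa≤0

    no-three-free-window : ∀ a → f a ≢ # 2 → f (1 + a) ≢ # 2 → f (2 + a) ≢ # 2 → f (3 + a) ≢ # 2 → ⊥
    no-three-free-window a n₀ n₁ n₂ n₃ = neighbours-differ a (toℕ-injective (trans fa≡0 (sym f1a≡0)))
      where
      fa≡0 : toℕ (f a) ≡ 0
      fa≡0 = at-distance-2 a
        (two-colors-alternate _ _ _ n₀ n₁ n₂ (neighbours-differ a) (neighbours-differ (1 + a)))
      f1a≡0 : toℕ (f (1 + a)) ≡ 0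
      f1a≡0 = at-distance-2 (1 + a)
        (two-colors-alternate _ _ _ n₁ n₂ n₃ (neighbours-differ (1 + a)) (neighbours-differ (2 + a)))

    three-isolated : ∀ a → f a ≡ # 2 → ∀ d → 0 < d → d ≤ 3 → f (d + a) ≢ # 2
    three-isolated a fa≡2 d 0<d d≤3 fda≡2 =
      <⇒≱ (s≤s d≤3) (subst (λ x → 2 + toℕ x ≤ d) fa≡2 (spread a d 0<d d≤3 (trans fa≡2 (sym fda≡2))))

    three-recurs : ∀ a → f a ≡ # 2 → f (4 + a) ≡ # 2
    three-recurs a fa≡2 = decidable-stable (f (4 + a) ≟ᶠ # 2)
      (no-three-free-window (1 + a) (isolated 1 z<s (s≤s z≤n)) (isolated 2 z<s (s≤s (s≤s z≤n)))
                                     (isolated 3 z<s (s≤s (s≤s (s≤s z≤n)))))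
      where
      isolated : ∀ d → 0 < d → d ≤ 3 → f (d + a) ≢ # 2
      isolated = three-isolated a fa≡2

    three-periodic : ∀ a → f a ≡ # 2 → ∀ m → f (4 * m + a) ≡ # 2
    three-periodic a fa≡2 zero = fa≡2
    three-periodic a fa≡2 (suc m) =
      subst (λ b → f b ≡ # 2) (trans (sym (+-assoc 4 (4 * m) a)) (cong (_+ a) (sym (*-suc 4 m))))
        (three-recurs (4 * m + a) (three-periodic a fa≡2 m))

    no-three : ∀ a → f a ≢ # 2
    no-three a fa≡2 = three-isolated b (three-periodic a fa≡2 q) r 0<r r≤3
      (trans (cong c (trans (cong w shift) (closed a))) fa≡2)
      where
      b : ℕ
      b = 4 * q + a
      rearrange : ∀ r q a → r + (4 * q + a) ≡ a + (4 * q + r)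
      rearrange = solve-∀
      shift : r + b ≡ a + (4 * q + r)
      shift = rearrange r q a

module CyclePositions (n : ℕ) .{{_ : NonZero n}} where

  open ≡-Reasoning

  position : ℕ → Fin n
  position a = a mod n

  toℕ-position : ∀ a → toℕ (position a) ≡ a % n
  toℕ-position a = toℕ-fromℕ< (m%n<n a n)

  position-periodic : ∀ a → position (a + n) ≡ position a
  position-periodic a =
    toℕ-injective (trans (toℕ-position (a + n)) (trans ([m+n]%n≡m%n a n) (sym (toℕ-position a))))

  toℕ-position-suc : 1 < n → ∀ a → toℕ (position (suc a)) ≡ suc (a % n) % n
  toℕ-position-suc 1<n a = begin
    toℕ (position (suc a))   ≡⟨ toℕ-position (suc a) ⟩
    (1 + a) % n              ≡⟨ %-distribˡ-+ 1 a n ⟩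
    (1 % n + a % n) % n      ≡⟨ cong (λ x → (x + a % n) % n) (m<n⇒m%n≡m 1<n) ⟩
    suc (a % n) % n          ∎

  position-step : 1 < n → ∀ a → CycleStep n (position a) (position (suc a))
  position-step 1<n a with suc (a % n) <? n
  ... | yes lt = inj₁ (begin
    toℕ (position (suc a))  ≡⟨ toℕ-position-suc 1<n a ⟩
    suc (a % n) % n         ≡⟨ m<n⇒m%n≡m lt ⟩
    suc (a % n)             ≡⟨ cong suc (toℕ-position a) ⟨
    suc (toℕ (position a))  ∎)
  ... | no ¬lt = inj₂ (trans (cong suc (toℕ-position a)) wrap ,
                       trans (toℕ-position-suc 1<n a) (trans (cong (_% n) wrap) (n%n≡0 n)))
    where
    wrap : suc (a % n) ≡ n
    wrap = ≤-antisym (m%n<n a n) (≮⇒≥ ¬lt)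

  position-separated : ∀ a d → 0 < d → d < n → position a ≢ position (d + a)
  position-separated a (suc d) 0<d d<n same = <⇒≱ d<n (∣⇒≤ n∣d)
    where
    rem≡ : (suc d + a) % n ≡ a % n
    rem≡ = sym (trans (sym (toℕ-position a)) (trans (cong toℕ same) (toℕ-position (suc d + a))))
    multiple : a / n * n + suc d ≡ (suc d + a) / n * n
    multiple = +-cancelˡ-≡ (a % n) (a / n * n + suc d) ((suc d + a) / n * n) (begin
      a % n + (a / n * n + suc d)            ≡⟨ +-assoc (a % n) _ _ ⟨
      a % n + a / n * n + suc d              ≡⟨ cong (_+ suc d) (m≡m%n+[m/n]*n a n) ⟨
      a + suc d                              ≡⟨ +-comm a (suc d) ⟩
      suc d + a                              ≡⟨ m≡m%n+[m/n]*n (suc d + a) n ⟩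
      (suc d + a) % n + (suc d + a) / n * n  ≡⟨ cong (_+ (suc d + a) / n * n) rem≡ ⟩
      a % n + (suc d + a) / n * n            ∎)
    n∣d : n ∣ suc d
    n∣d = ∣m+n∣m⇒∣n (subst (n ∣_) (sym multiple) (n∣m*n ((suc d + a) / n))) (n∣m*n (a / n))

product-not-3-colorable : ∀ {ℓ t s r} → 0 < t → 0 < s → 0 < r → r ≤ 3 →
                          ¬ PackingColorable (PathCycleProduct ℓ t (4 * s + r)) 3
product-not-3-colorable {ℓ} {suc t} {s@(suc _)} {r} _ _ 0<r r≤3 =
  ClosedWalk.no-packing-3-coloring w adjacent distinct-nearby {q = s} 0<r r≤3 closed
  where
  n : ℕ
  n = 4 * s + r
  open CyclePositions n

  4≤n : 4 ≤ n
  4≤n = ≤-trans (*-monoʳ-≤ 4 (s≤s z≤n)) (m≤m+n (4 * s) r)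

  w : ℕ → Fin (suc t) × Fin n
  w a = fzero , position a

  adjacent : ∀ a → Adj (PathCycleProduct ℓ (suc t) n) (w a) (w (suc a))
  adjacent a = inj₁ (inj₁ (refl , position-step (≤-trans (s≤s (s≤s z≤n)) 4≤n) a))

  distinct-nearby : ∀ a d → 0 < d → d ≤ 3 → w a ≢ w (d + a)
  distinct-nearby a d 0<d d≤3 same = position-separated a d 0<d (≤-trans (s≤s d≤3) 4≤n) (,-injectiveʳ same)

  closed : ∀ a → w (a + n) ≡ w a
  closed a = cong (fzero ,_) (position-periodic a)

module Cycle (n : ℕ) where

  Forward : ℕ → ℕ → Set
  Forward a b = (b ≡ suc a × b < n) ⊎ (suc a ≡ n × b ≡ 0)

  Forward-functional : ∀ {a b b′} → Forward a b → Forward a b′ → b ≡ b′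
  Forward-functional (inj₁ (refl , _)) (inj₁ (refl , _)) = refl
  Forward-functional (inj₁ (refl , b<n)) (inj₂ (1+a≡n , _)) = contradiction 1+a≡n (<⇒≢ b<n)
  Forward-functional (inj₂ (1+a≡n , _)) (inj₁ (refl , b<n)) = contradiction 1+a≡n (<⇒≢ b<n)
  Forward-functional (inj₂ (_ , refl)) (inj₂ (_ , refl)) = refl

  Forward-injective : ∀ {a a′ b} → Forward a b → Forward a′ b → a ≡ a′
  Forward-injective (inj₁ (refl , _)) (inj₁ (b≡1+a′ , _)) = suc-injective b≡1+a′
  Forward-injective (inj₁ (refl , _)) (inj₂ (_ , ()))
  Forward-injective (inj₂ (_ , refl)) (inj₁ (() , _))
  Forward-injective (inj₂ (1+a≡n , _)) (inj₂ (1+a′≡n , _)) = suc-injective (trans 1+a≡n (sym 1+a′≡n))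

  fromCycleStep : ∀ {j j′} → CycleStep n j j′ → Forward (toℕ j) (toℕ j′)
  fromCycleStep {j′ = j′} (inj₁ j′≡1+j) = inj₁ (j′≡1+j , toℕ<n j′)
  fromCycleStep (inj₂ wrap) = inj₂ wrap

  shortcut-cycle : ∀ {k a b} → Path (Lazy Forward) k a b → ∃ λ d → d ≤ k × OneWay Forward d a b
  shortcut-cycle = shortcut Forward-functional Forward-injective

-- collapse i m j: where position j of copy i goes when copy m is kept and every other copy is
-- folded onto the end of copy m it hangs from (position 0 on the left, position 1 on the right).
collapse : ℕ → ℕ → ℕ → ℕ
collapse zero    zero    j = j
collapse zero    (suc m) j = 0
collapse (suc i) zero    j = 1
collapse (suc i) (suc m) j = collapse i m j

collapse-self : ∀ i j → collapse i i j ≡ j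
collapse-self zero    j = refl
collapse-self (suc i) j = collapse-self i j

collapse-other : ∀ {i m} → i ≢ m → ∀ j j′ → collapse i m j ≡ collapse i m j′
collapse-other {zero}  {zero}  i≢m = contradiction refl i≢m
collapse-other {zero}  {suc m} i≢m j j′ = refl
collapse-other {suc i} {zero}  i≢m j j′ = refl
collapse-other {suc i} {suc m} i≢m = collapse-other (i≢m ∘ cong suc)

collapse-bridge : ∀ i m → collapse i m 1 ≡ collapse (suc i) m 0
collapse-bridge zero    zero          = refl
collapse-bridge zero    (suc zero)    = refl
collapse-bridge zero    (suc (suc m)) = refl
collapse-bridge (suc i) zero          = refl
collapse-bridge (suc i) (suc m)       = collapse-bridge i m

cost-extend : ∀ {b k₃ k₄ g a} → 1 ≤ k₃ → k₃ + (2 * g + 1) + k₄ ≤ a → b + (2 * suc g + 1) + k₄ ≤ b + suc a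
cost-extend {b} {k₃} {k₄} {g} {a} 1≤k₃ cost = begin
  b + (2 * suc g + 1) + k₄      ≡⟨ rearrange b g k₄ ⟩
  b + suc (1 + (2 * g + 1) + k₄)  ≤⟨ +-monoʳ-≤ b (s≤s (+-monoˡ-≤ k₄ (+-monoˡ-≤ (2 * g + 1) 1≤k₃))) ⟩
  b + suc (k₃ + (2 * g + 1) + k₄) ≤⟨ +-monoʳ-≤ b (s≤s cost) ⟩
  b + suc a                     ∎
  where
  open ≤-Reasoning
  rearrange : ∀ b g k → b + (2 * suc g + 1) + k ≡ b + suc (1 + (2 * g + 1) + k)
  rearrange = solve-∀

module Product (t n : ℕ) where

  open Cycle n

  H : Graph
  H = PathCycleProduct 2 t n

  Vertex : Set
  Vertex = Fin t × Fin n

  copy pos : Vertex → ℕ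
  copy = toℕ ∘ proj₁
  pos = toℕ ∘ proj₂

  retract : ℕ → Vertex → ℕ
  retract m (i , j) = collapse (toℕ i) m (toℕ j)

  retract-self : ∀ {m u} → copy u ≡ m → retract m u ≡ pos u
  retract-self {u = u} refl = collapse-self (copy u) (pos u)

  private
    within-copy : ∀ m i {a b} → SymClosure Forward a b → Lazy Forward (collapse i m a) (collapse i m b)
    within-copy m i {a} {b} s with i ≟ m
    ... | yes refl = subst₂ (Lazy Forward) (sym (collapse-self i a)) (sym (collapse-self i b)) [ s ]
    ... | no i≢m = subst (Lazy Forward (collapse i m a)) (collapse-other i≢m a b) ReflClosure.refl

    across-bridge : ∀ m {i i′ a b} → i′ ≡ suc i → a ≡ 1 → b ≡ 0 → collapse i m a ≡ collapse i′ m b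
    across-bridge m refl refl refl = collapse-bridge _ m

  retract-lazy : ∀ m {u v} → Adj H u v → Lazy Forward (retract m u) (retract m v)
  retract-lazy m {i , _} (inj₁ (inj₁ (refl , s))) = within-copy m (toℕ i) (fwd (fromCycleStep s))
  retract-lazy m (inj₁ (inj₂ (i′≡1+i , j≡1 , j′≡0))) = reflexive (across-bridge m i′≡1+i j≡1 j′≡0)
  retract-lazy m {i , _} (inj₂ (inj₁ (refl , s))) = within-copy m (toℕ i) (bwd (fromCycleStep s))
  retract-lazy m (inj₂ (inj₂ (i≡1+i′ , j′≡1 , j≡0))) = reflexive (sym (across-bridge m i≡1+i′ j′≡1 j≡0))

  same-copy-path : ∀ {k u v} → copy u ≡ copy v → Walk H k u v → Path (Lazy Forward) k (pos u) (pos v)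
  same-copy-path {u = u} u≡v w =
    subst₂ (Path (Lazy Forward) _) (retract-self {u = u} refl) (retract-self (sym u≡v))
      (Walk-map (retract (copy u)) (retract-lazy (copy u)) w)

  bridge-edge : ∀ m {x y} → Adj H x y → copy x ≤ m → m < copy y →
                copy x ≡ m × pos x ≡ 1 × copy y ≡ suc m × pos y ≡ 0
  bridge-edge m (inj₁ (inj₁ (refl , _))) x≤m m<y = contradiction x≤m (<⇒≱ m<y)
  bridge-edge m {x} (inj₁ (inj₂ (y≡1+x , x≡1 , y≡0))) x≤m m<y = x≡m , x≡1 , trans y≡1+x (cong suc x≡m) , y≡0
    where
    x≡m : copy x ≡ m
    x≡m = ≤-antisym x≤m (≤-pred (subst (m <_) y≡1+x m<y))
  bridge-edge m (inj₂ (inj₁ (refl , _))) x≤m m<y = contradiction x≤m (<⇒≱ m<y)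
  bridge-edge m (inj₂ (inj₂ (x≡1+y , _))) x≤m m<y =
    contradiction (≤-trans x≤m (<⇒≤ m<y)) (<⇒≱ (≤-reflexive (sym x≡1+y)))

  record Exit (m k : ℕ) (u v : Vertex) : Set where
    field
      before after : ℕ
      length : k ≡ before + suc after
      approach : Path (Lazy Forward) before (retract m u) 1
      landing : Vertex
      lands : copy landing ≡ suc m × pos landing ≡ 0
      rest : Walk H after landing v

  first-exit : ∀ m {k u v} → Walk H k u v → copy u ≤ m → m < copy v → Exit m k u v
  first-exit m here u≤m m<u = contradiction u≤m (<⇒≱ m<u)
  first-exit m {u = u} (step {w = x} a w) u≤m m<v with copy x ≤? m
  ... | yes x≤m = record
    { before = suc before ; after = after ; length = cong suc length
    ; approach = retract-lazy m a ∷ approach ; landing = landing ; lands = lands ; rest = rest }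
    where open Exit (first-exit m w x≤m m<v)
  ... | no x≰m with bridge-edge m a u≤m (≰⇒> x≰m)
  ...   | u≡m , u≡1 , x≡1+m , x≡0 = record
    { before = 0 ; after = _ ; length = refl
    ; approach = subst (λ a → Path (Lazy Forward) 0 a 1) (sym (trans (retract-self u≡m) u≡1)) []
    ; landing = x ; lands = x≡1+m , x≡0 ; rest = w }

  -- A walk from copy i to copy i + g + 1 runs from its start to position 1 of copy i, crosses g
  -- intermediate copies (from position 0 to position 1 in each), and ends from position 0.
  CrossingBound : ℕ → ℕ → Vertex → Vertex → Set
  CrossingBound g k u v = ∃₂ λ k₁ k₂ →
    Path (Lazy Forward) k₁ (pos u) 1 × Path (Lazy Forward) k₂ 0 (pos v) × k₁ + (2 * g + 1) + k₂ ≤ k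

  crossing-cost : ∀ g {k u v} → Walk H k u v → copy v ≡ copy u + suc g → CrossingBound g k u v
  beyond-exit : ∀ g {k u v} → copy v ≡ copy u + suc g → Exit (copy u) k u v → CrossingBound g k u v

  crossing-cost g {u = u} w v≡u+1+g =
    beyond-exit g v≡u+1+g
      (first-exit (copy u) w ≤-refl (subst (copy u <_) (sym v≡u+1+g) (m<m+n (copy u) z<s)))

  exit-approach : ∀ {k u v} → (e : Exit (copy u) k u v) → Path (Lazy Forward) (Exit.before e) (pos u) 1
  exit-approach {u = u} e =
    subst (λ a → Path (Lazy Forward) _ a 1) (retract-self {u = u} refl) (Exit.approach e)

  beyond-exit zero {u = u} {v} v≡u+1 e = before , after , exit-approach e ,
    subst (λ a → Path (Lazy Forward) after a (pos v)) (proj₂ lands)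
      (same-copy-path (trans (proj₁ lands) (trans (+-comm 1 (copy u)) (sym v≡u+1))) rest) ,
    ≤-reflexive (trans (+-assoc before 1 after) (sym length))
    where open Exit e
  beyond-exit (suc g) {u = u} {v} v≡u+2+g e = extend (crossing-cost g rest v≡landing+1+g)
    where
    open Exit e
    v≡landing+1+g : copy v ≡ copy landing + suc g
    v≡landing+1+g = trans v≡u+2+g (trans (+-suc (copy u) (suc g)) (cong (_+ suc g) (sym (proj₁ lands))))
    extend : CrossingBound g after landing v → CrossingBound (suc g) _ u v
    extend (k₃ , k₄ , p₃ , p₄ , cost) =
      before , k₄ , exit-approach e , p₄ ,
      subst (before + (2 * suc g + 1) + k₄ ≤_) (sym length) (cost-extend {g = g} 1≤k₃ cost)
      where
      1≤k₃ : 1 ≤ k₃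
      1≤k₃ = Path-nonempty (λ 0≡1 → 0≢1+n (trans (sym (proj₂ lands)) 0≡1)) p₃

Label : Set
Label = Fin 13

successors : Label → List Label
successors l = lookup table l
  where
  table : Vec (List Label) 13
  table = (# 1 ∷ []) ∷ᵥ (# 2 ∷ []) ∷ᵥ (# 3 ∷ []) ∷ᵥ (# 4 ∷ []) ∷ᵥ (# 6 ∷ # 12 ∷ [])
       ∷ᵥ (# 6 ∷ # 12 ∷ []) ∷ᵥ (# 7 ∷ []) ∷ᵥ (# 8 ∷ []) ∷ᵥ (# 5 ∷ [])
       ∷ᵥ (# 0 ∷ []) ∷ᵥ (# 9 ∷ []) ∷ᵥ (# 10 ∷ []) ∷ᵥ (# 11 ∷ []) ∷ᵥ []ᵥ

LabelEdge : Label → Label → Set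
LabelEdge l m = m ∈ successors l

path? : ∀ d l m → Dec (Path LabelEdge d l m)
path? zero l m = map′ (λ { refl → [] }) Path-length0 (l ≟ᶠ m)
path? (suc d) l m =
  map′ (λ p → let (x , l→x , x⇝m) = find p in l→x ∷ x⇝m) (λ { (l→x ∷ x⇝m) → lose l→x x⇝m })
       (any? (λ x → path? d x m) (successors l))

startLabel : ℕ → Label
startLabel 0 = # 0
startLabel 1 = # 1
startLabel 2 = # 2
startLabel 3 = # 3
startLabel _ = # 4

middleLabel : ℕ → Label
middleLabel 0 = # 5
middleLabel 1 = # 6
middleLabel 2 = # 7
middleLabel 3 = # 8
middleLabel (suc (suc (suc (suc a)))) = middleLabel a

endLabel : ℕ → Label
endLabel 0 = # 9
endLabel 1 = # 10
endLabel 2 = # 11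
endLabel _ = # 12

label : ℕ → ℕ → Label
label n a with a ≤? 4 | n ∸ suc a ≤? 3
... | yes _ | _     = startLabel a
... | no _  | yes _ = endLabel (n ∸ suc a)
... | no _  | no _  = middleLabel a

module _ {n a : ℕ} where

  label-end : ¬ a ≤ 4 → n ∸ suc a ≤ 3 → label n a ≡ endLabel (n ∸ suc a)
  label-end a≰4 e≤3 with a ≤? 4 | n ∸ suc a ≤? 3
  ... | yes a≤4 | _ = contradiction a≤4 a≰4
  ... | no _ | yes _ = refl
  ... | no _ | no e≰3 = contradiction e≤3 e≰3

  label-middle : ¬ a ≤ 4 → ¬ n ∸ suc a ≤ 3 → label n a ≡ middleLabel a
  label-middle a≰4 e≰3 with a ≤? 4 | n ∸ suc a ≤? 3
  ... | yes a≤4 | _ = contradiction a≤4 a≰4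
  ... | no _ | yes e≤3 = contradiction e≤3 e≰3
  ... | no _ | no _ = refl

middleLabel-edge : ∀ a → LabelEdge (middleLabel a) (middleLabel (suc a))
middleLabel-edge 0 = here refl
middleLabel-edge 1 = here refl
middleLabel-edge 2 = here refl
middleLabel-edge 3 = here refl
middleLabel-edge (suc (suc (suc (suc a)))) = middleLabel-edge a

endLabel-edge : ∀ {e} → e < 3 → LabelEdge (endLabel (suc e)) (endLabel e)
endLabel-edge {0} _ = here refl
endLabel-edge {1} _ = here refl
endLabel-edge {2} _ = here refl
endLabel-edge {suc (suc (suc _))} (s≤s (s≤s (s≤s ())))

middleLabel-multiple : ∀ q → middleLabel (q * 4) ≡ # 5
middleLabel-multiple zero = refl
middleLabel-multiple (suc q) = middleLabel-multiple q

∸-suc : ∀ {m n} → m < n → n ∸ m ≡ suc (n ∸ suc m)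
∸-suc {zero} {suc n} _ = refl
∸-suc {suc m} {suc n} (s≤s m<n) = ∸-suc m<n

module LabelHomomorphism (q : ℕ) where

  n : ℕ
  n = 9 + q * 4

  open Cycle n

  private
    -- The last middle position n - 5 = 4(q + 1) has residue 0: this is where n ≡ 1 (mod 4) is used.
    last-middle : ∀ {a} → suc a < n → n ∸ suc a ≡ 4 → middleLabel a ≡ # 5
    last-middle {a} 1+a<n e≡4 = trans (cong middleLabel a≡4+4q) (middleLabel-multiple q)
      where
      a≡4+4q : a ≡ 4 + q * 4
      a≡4+4q = +-cancelˡ-≡ 5 a (4 + q * 4)
        (trans (sym (+-suc 4 a)) (trans (cong (_+ suc a) (sym e≡4)) (m∸n+n≡m (<⇒≤ 1+a<n))))

    beyond-start : ∀ {a} → 4 < a → suc a < n → LabelEdge (label n a) (label n (suc a))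
    beyond-start {a} 4<a 1+a<n = by-region (n ∸ suc a ≤? 3) (n ∸ suc (suc a) ≤? 3)
      where
      a≰4 : ¬ a ≤ 4
      a≰4 = <⇒≱ 4<a
      1+a≰4 : ¬ suc a ≤ 4
      1+a≰4 = <⇒≱ (m<n⇒m<1+n 4<a)
      e≡1+e′ : n ∸ suc a ≡ suc (n ∸ suc (suc a))
      e≡1+e′ = ∸-suc 1+a<n
      by-region : Dec (n ∸ suc a ≤ 3) → Dec (n ∸ suc (suc a) ≤ 3) → LabelEdge (label n a) (label n (suc a))
      by-region (yes e≤3) (yes e′≤3) =
        subst₂ LabelEdge (sym (trans (label-end {n} a≰4 e≤3) (cong endLabel e≡1+e′)))
                         (sym (label-end {n} 1+a≰4 e′≤3))
          (endLabel-edge (subst (_≤ 3) e≡1+e′ e≤3))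
      by-region (yes e≤3) (no e′≰3) = contradiction (≤-trans (n≤1+n _) (subst (_≤ 3) e≡1+e′ e≤3)) e′≰3
      by-region (no e≰3) (yes e′≤3) =
        subst₂ LabelEdge (sym (trans (label-middle {n} a≰4 e≰3) (last-middle 1+a<n e≡4)))
                         (sym (trans (label-end {n} 1+a≰4 e′≤3) (cong endLabel e′≡3))) (there (here refl))
        where
        e′≡3 : n ∸ suc (suc a) ≡ 3
        e′≡3 = ≤-antisym e′≤3 (≤-pred (subst (3 <_) e≡1+e′ (≰⇒> e≰3)))
        e≡4 : n ∸ suc a ≡ 4
        e≡4 = trans e≡1+e′ (cong suc e′≡3)
      by-region (no e≰3) (no e′≰3) =
        subst₂ LabelEdge (sym (label-middle {n} a≰4 e≰3)) (sym (label-middle {n} 1+a≰4 e′≰3))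
          (middleLabel-edge a)

    from-4 : Dec (n ∸ 6 ≤ 3) → LabelEdge (label n 4) (label n 5)
    from-4 (yes e≤3) = subst (LabelEdge (# 4)) (sym (label-end {n} 1+n≰n e≤3)) (there (here refl))
    from-4 (no e≰3) = subst (LabelEdge (# 4)) (sym (label-middle {n} 1+n≰n e≰3)) (here refl)

  label-edge : ∀ {a b} → Forward a b → LabelEdge (label n a) (label n b)
  label-edge {a} (inj₂ (1+a≡n , refl)) =
    subst (λ l → LabelEdge l (# 0))
      (sym (trans (label-end {n} a≰4 (subst (_≤ 3) (sym e≡0) z≤n)) (cong endLabel e≡0))) (here refl)
    where
    e≡0 : n ∸ suc a ≡ 0
    e≡0 = trans (cong (n ∸_) 1+a≡n) (n∸n≡0 n)
    a≰4 : ¬ a ≤ 4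
    a≰4 a≤4 = <⇒≱ 5<n (subst (_≤ 5) 1+a≡n (s≤s a≤4))
      where
      5<n : 5 < n
      5<n = s≤s (s≤s (s≤s (s≤s (s≤s (s≤s z≤n)))))
  label-edge {0} (inj₁ (refl , _)) = here refl
  label-edge {1} (inj₁ (refl , _)) = here refl
  label-edge {2} (inj₁ (refl , _)) = here refl
  label-edge {3} (inj₁ (refl , _)) = here refl
  label-edge {4} (inj₁ (refl , _)) = from-4 (n ∸ 6 ≤? 3)
  label-edge {suc (suc (suc (suc (suc a))))} (inj₁ (refl , 1+a<n)) =
    beyond-start (s≤s (s≤s (s≤s (s≤s (s≤s z≤n))))) 1+a<n

CopyType : Set
CopyType = Fin 5

nextType : CopyType → CopyType
nextType τ = lookup (# 1 ∷ᵥ # 2 ∷ᵥ # 3 ∷ᵥ # 4 ∷ᵥ # 3 ∷ᵥ []ᵥ) τ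

copyType : ℕ → CopyType
copyType = iterate nextType (# 0)

iterate-+ : ∀ {A : Set} (f : A → A) x m n → iterate f x (m + n) ≡ iterate f (iterate f x m) n
iterate-+ f x zero n = refl
iterate-+ f x (suc m) n = iterate-+ f (f x) m n

colorTable : CopyType → Label → Fin 5
colorTable τ l = lookup (lookup table τ) l
  where
  table : Vec (Vec (Fin 5) 13) 5
  table =
       (# 0 ∷ᵥ # 1 ∷ᵥ # 0 ∷ᵥ # 2 ∷ᵥ # 0 ∷ᵥ # 0 ∷ᵥ # 1 ∷ᵥ # 0 ∷ᵥ # 2 ∷ᵥ # 2 ∷ᵥ # 3 ∷ᵥ # 0 ∷ᵥ # 1 ∷ᵥ []ᵥ)
    ∷ᵥ (# 0 ∷ᵥ # 3 ∷ᵥ # 0 ∷ᵥ # 1 ∷ᵥ # 2 ∷ᵥ # 2 ∷ᵥ # 0 ∷ᵥ # 1 ∷ᵥ # 0 ∷ᵥ # 2 ∷ᵥ # 0 ∷ᵥ # 1 ∷ᵥ # 0 ∷ᵥ []ᵥ)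
    ∷ᵥ (# 0 ∷ᵥ # 1 ∷ᵥ # 0 ∷ᵥ # 2 ∷ᵥ # 0 ∷ᵥ # 0 ∷ᵥ # 1 ∷ᵥ # 0 ∷ᵥ # 2 ∷ᵥ # 2 ∷ᵥ # 1 ∷ᵥ # 0 ∷ᵥ # 3 ∷ᵥ []ᵥ)
    ∷ᵥ (# 0 ∷ᵥ # 2 ∷ᵥ # 0 ∷ᵥ # 1 ∷ᵥ # 0 ∷ᵥ # 0 ∷ᵥ # 2 ∷ᵥ # 0 ∷ᵥ # 1 ∷ᵥ # 4 ∷ᵥ # 1 ∷ᵥ # 0 ∷ᵥ # 2 ∷ᵥ []ᵥ)
    ∷ᵥ (# 0 ∷ᵥ # 1 ∷ᵥ # 0 ∷ᵥ # 2 ∷ᵥ # 0 ∷ᵥ # 0 ∷ᵥ # 1 ∷ᵥ # 0 ∷ᵥ # 2 ∷ᵥ # 3 ∷ᵥ # 0 ∷ᵥ # 4 ∷ᵥ # 1 ∷ᵥ []ᵥ)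
    ∷ᵥ []ᵥ

within-copy-check : ∀ τ l m → colorTable τ l ≡ colorTable τ m →
  ∀ {d} → d < 6 → 0 < d → d ≤ suc (toℕ (colorTable τ l)) → ¬ OneWay LabelEdge d l m
within-copy-check = from-yes
  (all? λ τ → all? λ l → all? λ m → colorTable τ l ≟ᶠ colorTable τ m →-dec
    allUpTo? (λ d → 0 <? d →-dec d ≤? suc (toℕ (colorTable τ l)) →-dec
                    ¬? (path? d l m ⊎-dec path? d m l)) 6)

across-copies-check : ∀ τ {g} → g < 6 → ∀ l m → colorTable τ l ≡ colorTable (iterate nextType τ (suc g)) m →
  ∀ {d₁} → d₁ < 6 → ∀ {d₂} → d₂ < 6 → d₁ + (2 * g + 1) + d₂ ≤ suc (toℕ (colorTable τ l)) →
  OneWay LabelEdge d₁ l (# 1) → ¬ OneWay LabelEdge d₂ (# 0) m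
across-copies-check = from-yes
  (all? λ τ → allUpTo? (λ g → all? λ l → all? λ m →
    colorTable τ l ≟ᶠ colorTable (iterate nextType τ (suc g)) m →-dec
    allUpTo? (λ d₁ → allUpTo? (λ d₂ → d₁ + (2 * g + 1) + d₂ ≤? suc (toℕ (colorTable τ l)) →-dec
      (path? d₁ l (# 1) ⊎-dec path? d₁ (# 1) l) →-dec ¬? (path? d₂ (# 0) m ⊎-dec path? d₂ m (# 0))) 6) 6) 6)

first-copies-check : ∀ {i} → i < 3 → ∀ l → toℕ (colorTable (copyType i) l) < 4
first-copies-check = from-yes (allUpTo? (λ i → all? λ l → toℕ (colorTable (copyType i) l) <? 4) 3)

<-gap : ∀ {m n} → m < n → ∃ λ g → n ≡ m + suc g
<-gap {m} m<n with m≤n⇒∃[o]m+o≡n m<n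
... | g , 1+m+g≡n = g , sym (trans (+-suc m g) 1+m+g≡n)

below-6 : ∀ {x y} (c : Fin 5) → x ≤ y → y ≤ suc (toℕ c) → x < 6
below-6 c x≤y y≤c+1 = s≤s (≤-trans (≤-trans x≤y y≤c+1) (toℕ<n c))

module FiveColoring (q t : ℕ) where

  open LabelHomomorphism q
  open Cycle n
  open Product t n

  coloring : Vertex → Fin 5
  coloring (i , j) = colorTable (copyType (toℕ i)) (label n (toℕ j))

  label-oneWay : ∀ {d a b} → OneWay Forward d a b → OneWay LabelEdge d (label n a) (label n b)
  label-oneWay = OneWay-map (label n) label-edge

  Separated : ℕ → Vertex → Set
  Separated k u = ¬ k < 2 + toℕ (coloring u)

  separated-within-copy : ∀ {k u v} → copy u ≡ copy v → u ≢ v → coloring u ≡ coloring v → Walk H k u v →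
                          Separated k u
  separated-within-copy {k} {u} {v} u≡v u≢v same w k<c+2 with shortcut-cycle (same-copy-path u≡v w)
  ... | zero , _ , p = u≢v (cong₂ _,_ (toℕ-injective u≡v) (toℕ-injective (OneWay-length0 p)))
  ... | suc d , d≤k , p =
    within-copy-check τ _ _ same′ (below-6 c d≤k k≤c+1) z<s (≤-trans d≤k k≤c+1) (label-oneWay p)
    where
    τ : CopyType
    τ = copyType (copy u)
    c : Fin 5
    c = coloring u
    k≤c+1 : k ≤ suc (toℕ c)
    k≤c+1 = ≤-pred k<c+2
    same′ : colorTable τ (label n (pos u)) ≡ colorTable τ (label n (pos v))
    same′ = trans same (cong (λ i → colorTable (copyType i) (label n (pos v))) (sym u≡v))

  separated-across-copies : ∀ {k u v} → copy u < copy v → coloring u ≡ coloring v → Walk H k u v →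
                            Separated k u
  separated-across-copies {k} {u} {v} u<v same w k<c+2 with <-gap u<v
  ... | g , v≡u+1+g with crossing-cost g w v≡u+1+g
  ...   | k₁ , k₂ , p₁ , p₂ , cost with shortcut-cycle p₁ | shortcut-cycle p₂
  ...     | d₁ , d₁≤k₁ , o₁ | d₂ , d₂≤k₂ , o₂ =
    across-copies-check τ (bounded g≤total) _ _ same′ (bounded d₁≤total) (bounded (m≤n+m d₂ _)) total≤
      (label-oneWay o₁) (label-oneWay o₂)
    where
    τ : CopyType
    τ = copyType (copy u)
    c : Fin 5
    c = coloring u
    total≤ : d₁ + (2 * g + 1) + d₂ ≤ suc (toℕ c)
    total≤ = ≤-trans (+-mono-≤ (+-monoˡ-≤ (2 * g + 1) d₁≤k₁) d₂≤k₂) (≤-trans cost (≤-pred k<c+2))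
    bounded : ∀ {x} → x ≤ d₁ + (2 * g + 1) + d₂ → x < 6
    bounded x≤total = below-6 c x≤total total≤
    g≤total : g ≤ d₁ + (2 * g + 1) + d₂
    g≤total = ≤-trans (≤-trans (m≤m+n g (g + 0)) (m≤m+n _ 1)) (≤-trans (m≤n+m _ d₁) (m≤m+n _ d₂))
    d₁≤total : d₁ ≤ d₁ + (2 * g + 1) + d₂
    d₁≤total = ≤-trans (m≤m+n d₁ _) (m≤m+n _ d₂)
    same′ : colorTable τ (label n (pos u)) ≡ colorTable (iterate nextType τ (suc g)) (label n (pos v))
    same′ = trans same (cong (λ τ′ → colorTable τ′ (label n (pos v)))
              (trans (cong copyType v≡u+1+g) (iterate-+ nextType (# 0) (copy u) (suc g))))

  first-copies-four-colored : t ≤ 3 → ∀ v → toℕ (coloring v) < 4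
  first-copies-four-colored t≤3 (i , _) = first-copies-check (<-≤-trans (toℕ<n i) t≤3) _

  is-packing : IsPackingColoring H 5 coloring
  is-packing u v u≢v same k k<c+2 w with <-cmp (copy u) (copy v)
  ... | tri< u<v _ _ = separated-across-copies u<v same w k<c+2
  ... | tri≈ _ u≡v _ = separated-within-copy u≡v u≢v same w k<c+2
  ... | tri> _ _ v<u =
    separated-across-copies v<u (sym same) (Walk-reverse swap w) (subst (λ c → k < 2 + toℕ c) same k<c+2)

cycle-length : ∀ q → 4 * (2 + q) + 1 ≡ 9 + q * 4
cycle-length = solve-∀

five-colorable : ∀ t {s} → 2 ≤ s → PackingColorable (PathCycleProduct 2 t (4 * s + 1)) 5
five-colorable t (s≤s (s≤s {n = q} z≤n)) =
  subst (λ n → PackingColorable (PathCycleProduct 2 t n) 5) (sym (cycle-length q)) (coloring , is-packing)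
  where open FiveColoring q t

four-colorable : ∀ {t s} → t ≤ 3 → 2 ≤ s → PackingColorable (PathCycleProduct 2 t (4 * s + 1)) 4
four-colorable {t} t≤3 (s≤s (s≤s {n = q} z≤n)) =
  subst (λ n → PackingColorable (PathCycleProduct 2 t n) 4) (sym (cycle-length q))
    (restrict-colors is-packing (first-copies-four-colored t≤3))
  where open FiveColoring q t

theorem4 : (t s : ℕ) → 1 ≤ t → 2 ≤ s →
    ((t ≤ 3 → χp≤ (PathCycleProduct 2 t (4 * s + 1)) 4)
    × (4 ≤ t → χp≤ (PathCycleProduct 2 t (4 * s + 1)) 5))
    × (t ≤ 3 → χp≡ (PathCycleProduct 2 t (4 * s + 1)) 4)
theorem4 t s 1≤t 2≤s =
  ((λ t≤3 → four-colorable t≤3 2≤s) , (λ _ → five-colorable t 2≤s)) ,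
  (λ t≤3 → four-colorable t≤3 2≤s , fewer-colors-impossible)
  where
  fewer-colors-impossible : ∀ j → j < 4 → ¬ PackingColorable (PathCycleProduct 2 t (4 * s + 1)) j
  fewer-colors-impossible j j<4 =
    product-not-3-colorable {ℓ = 2} 1≤t (<-≤-trans z<s 2≤s) z<s (s≤s z≤n)
      ∘ PackingColorable-mono (≤-pred j<4)
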